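{- Let $G$ be a graph with no isolated vertices and $\gamma_{tR}(G)=k\geq 4$. Then $G$ is a spanning subgraph of a $k$-$\gamma_{tR}$-edge-critical graph.
   Context: All graphs are finite and simple. For a graph $G$ with no isolated vertices, a total Roman dominating function is a map $f:V(G)\to\{0,1,2\}$ such that every vertex with $f(v)=0$ is adjacent to a vertex $u$ with $f(u)=2$, and the subgraph induced by $\{v:f(v)>0\}$ has no isolated vertices; $\gamma_{tR}(G)$ is the minimum of $\sum_v f(v)$ over such $f$. $G$ is $k$-$\gamma_{tR}$-edge-critical if $\gamma_{tR}(G)=k$, $E(\overline{G})\neq\emptyset$ and $\gamma_{tR}(G+e)<\gamma_{tR}(G)$ for every $e\in E(\overline{G})$. -}

module Defs where

open import Data.Nat using (ℕ; _<_; _≤_)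
open import Data.Fin using (Fin; toℕ; _≟_)
open import Data.List using (map; allFin)
open import Data.Nat.ListAction using (sum)
open import Data.Bool using (Bool; true; false; _∨_; _∧_)
open import Data.Empty using (⊥-elim)
open import Data.Bool.Properties using (∨-comm)
open import Data.Product using (Σ; ∃; ∃-syntax; _×_; _,_; proj₁)
open import Relation.Nullary using (¬_; yes; no)
open import Relation.Binary.PropositionalEquality using (_≡_; _≢_; refl; sym; cong₂)

record Graph (n : ℕ) : Set where
  field
    adj    : Fin n → Fin n → Bool
    adj-sym    : ∀ x y → adj x y ≡ adj y x
    adj-irrefl : ∀ x → adj x x ≡ false
open Graph public

Adj : ∀ {n} → Graph n → Fin n → Fin n → Set
Adj G x y = adj G x y ≡ true

NoIsolated : ∀ {n} → Graph n → Set
NoIsolated {n} G = ∀ (v : Fin n) → ∃[ u ] Adj G v u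

SpanningSubgraph : ∀ {n} → Graph n → Graph n → Set
SpanningSubgraph {n} G H = ∀ (x y : Fin n) → Adj G x y → Adj H x y

NonEdge : ∀ {n} → Graph n → Fin n → Fin n → Set
NonEdge G u v = (u ≢ v) × (adj G u v ≡ false)

eqb : ∀ {n} → Fin n → Fin n → Bool
eqb x y with x ≟ y
... | yes _ = true
... | no  _ = false

eqb-sym : ∀ {n} (x y : Fin n) → eqb x y ≡ eqb y x
eqb-sym x y with x ≟ y | y ≟ x
... | yes _ | yes _ = refl
... | yes p | no ¬q = ⊥-elim (¬q (sym p))
... | no ¬p | yes q = ⊥-elim (¬p (sym q))
... | no _  | no _  = refl

pairb : ∀ {n} → Fin n → Fin n → Fin n → Fin n → Bool
pairb u v x y = (eqb x u ∧ eqb y v) ∨ (eqb x v ∧ eqb y u)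

private
  pairb-sym : ∀ {n} (u v x y : Fin n) → pairb u v x y ≡ pairb u v y x
  pairb-sym u v x y with eqb x u | eqb y v | eqb x v | eqb y u
  ... | true  | true  | true  | true  = refl
  ... | true  | true  | true  | false = refl
  ... | true  | true  | false | true  = refl
  ... | true  | true  | false | false = refl
  ... | true  | false | true  | true  = refl
  ... | true  | false | true  | false = refl
  ... | true  | false | false | true  = refl
  ... | true  | false | false | false = refl
  ... | false | true  | true  | true  = refl
  ... | false | true  | true  | false = refl
  ... | false | true  | false | true  = refl
  ... | false | true  | false | false = refl
  ... | false | false | true  | true  = refl
  ... | false | false | true  | false = refl
  ... | false | false | false | true  = refl
  ... | false | false | false | false = refl

  pairb-irr : ∀ {n} (u v : Fin n) → u ≢ v → ∀ x → pairb u v x x ≡ false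
  pairb-irr u v u≢v x with x ≟ u | x ≟ v
  ... | yes refl | yes refl = ⊥-elim (u≢v refl)
  ... | yes _ | no _ = refl
  ... | no _ | yes _ = refl
  ... | no _ | no _ = refl

addEdge : ∀ {n} (G : Graph n) (u v : Fin n) → u ≢ v → Graph n
addEdge G u v u≢v = record
  { adj    = λ x y → adj G x y ∨ pairb u v x y
  ; adj-sym    = λ x y → cong₂ _∨_ (adj-sym G x y) (pairb-sym u v x y)
  ; adj-irrefl = λ x → cong₂ _∨_ (adj-irrefl G x) (pairb-irr u v u≢v x)
  }

weight : ∀ {n} → (Fin n → Fin 3) → ℕ
weight {n} f = sum (map (λ v → toℕ (f v)) (allFin n))

IsTRDF : ∀ {n} → Graph n → (Fin n → Fin 3) → Set
IsTRDF {n} G f =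
  (∀ (v : Fin n) → toℕ (f v) ≡ 0 → ∃[ u ] (Adj G v u × toℕ (f u) ≡ 2))
  × (∀ (v : Fin n) → ¬ (toℕ (f v) ≡ 0) → ∃[ u ] (Adj G v u × ¬ (toℕ (f u) ≡ 0)))

IsγtR : ∀ {n} → Graph n → ℕ → Set
IsγtR {n} G k =
  (∃[ f ] (IsTRDF G f × weight f ≡ k))
  × (∀ (f : Fin n → Fin 3) → IsTRDF G f → k ≤ weight f)

EdgeCritical : ∀ {n} → Graph n → ℕ → Set
EdgeCritical {n} G k =
  NoIsolated G
  × IsγtR G k
  × (∃[ u ] ∃[ v ] NonEdge G u v)
  × (∀ (u v : Fin n) (ne : NonEdge G u v) →
       ∃[ m ] (m < k × IsγtR (addEdge G u v (proj₁ ne)) m))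

-- Add the missing edges one at a time, keeping an edge only if it does not lower
-- γ_tR. Adding edges never raises γ_tR, so an edge that was rejected (it would have
-- lowered γ_tR below k) would still lower it in every later supergraph; after all
-- pairs have been tried the result H still has γ_tR(H) = k and adding any missing
-- edge lowers it. H is not complete, because a complete graph on at least two
-- vertices has the total Roman dominating function (2, 1, 0, …, 0) of weight 3 < k.
module Submission where

open import Defs
open import Data.Nat using (ℕ; zero; suc; _+_; _≤_; _<_; z≤n)
open import Data.Nat.Properties using (≤-trans; ≮⇒≥; ≤-<-trans; <⇒≱; _<?_)
open import Data.Nat.Induction using (<-wellFounded)
open import Induction.WellFounded using (Acc; acc)
open import Data.Fin using (Fin; toℕ; _≟_; #_)
import Data.Fin as Fin
open import Data.Fin.Properties using (any?; all?)
open import Data.Vec.Functional using (head; tail) renaming (_∷_ to _∷ᵥ_)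
open import Data.Bool using (true; false)
open import Data.Bool.Properties using (∨-zeroʳ; ¬-not)
import Data.Bool.Properties as Bool
import Data.Nat.Properties as ℕ
open import Data.List using (List; []; _∷_; map; tabulate; allFin; cartesianProduct)
open import Data.List.Properties using (map-cong; map-tabulate)
open import Data.Nat.ListAction using (sum)
open import Data.List.Relation.Unary.All using (All; []; _∷_; lookup)
open import Data.List.Membership.Propositional.Properties using (∈-cartesianProduct⁺; ∈-allFin)
open import Data.Product using (Σ; _×_; _,_; proj₁; ∃; ∃-syntax)
open import Data.Sum using (_⊎_; inj₁; inj₂)
open import Function using (_∘_)
open import Relation.Nullary using (¬_; Dec; yes; no; contradiction)
open import Relation.Nullary.Decidable using (_×-dec_; _→-dec_; ¬?; map′)
open import Relation.Binary.PropositionalEquality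

private
  variable
    n k m : ℕ

∃-function? : ∀ n {m} (Q : (Fin n → Fin m) → Set) →
  (∀ {f g} → f ≗ g → Q f → Q g) → (∀ f → Dec (Q f)) → Dec (∃ Q)
∃-function? zero Q resp Q? =
  map′ (λ q → _ , q) (λ { (f , q) → resp (λ ()) q }) (Q? (λ ()))
∃-function? (suc n) Q resp Q? =
  map′ (λ { (a , f , q) → a ∷ᵥ f , q })
       (λ { (f , q) → head f , tail f , resp (λ { Fin.zero → refl ; (Fin.suc i) → refl }) q })
       (any? λ a → ∃-function? n (Q ∘ (a ∷ᵥ_)) (λ f≗g → resp (λ { Fin.zero → refl ; (Fin.suc i) → f≗g i }))
                                           (Q? ∘ (a ∷ᵥ_)))

weight-cong : {f g : Fin n → Fin 3} → f ≗ g → weight f ≡ weight g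
weight-cong {n} f≗g = cong sum (map-cong (cong toℕ ∘ f≗g) (allFin n))

weight-suc : (f : Fin (suc n) → Fin 3) → weight f ≡ toℕ (f Fin.zero) + weight (f ∘ Fin.suc)
weight-suc {n} f = cong (toℕ (f Fin.zero) +_) (cong sum (begin
  map (toℕ ∘ f) (tabulate Fin.suc)    ≡⟨ map-tabulate Fin.suc (toℕ ∘ f) ⟩
  tabulate (toℕ ∘ f ∘ Fin.suc)        ≡⟨ sym (map-tabulate (λ i → i) (toℕ ∘ f ∘ Fin.suc)) ⟩
  map (toℕ ∘ f ∘ Fin.suc) (allFin n)  ∎))
  where open ≡-Reasoning

weight-zero : weight {n} (λ _ → Fin.zero) ≡ 0
weight-zero {zero} = refl
weight-zero {suc n} = trans (weight-suc {n} (λ _ → Fin.zero)) (weight-zero {n})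

IsTRDF-cong : (G : Graph n) {f g : Fin n → Fin 3} → f ≗ g → IsTRDF G f → IsTRDF G g
IsTRDF-cong G {f} {g} f≗g (dominated , paired) =
  (λ v gv≡0 → let (u , v~u , fu≡2) = dominated v (subst (λ a → toℕ a ≡ 0) (sym (f≗g v)) gv≡0)
              in u , v~u , subst (λ a → toℕ a ≡ 2) (f≗g u) fu≡2) ,
  (λ v gv≢0 → let (u , v~u , fu≢0) = paired v (gv≢0 ∘ subst (λ a → toℕ a ≡ 0) (f≗g v))
              in u , v~u , fu≢0 ∘ subst (λ a → toℕ a ≡ 0) (sym (f≗g u)))

IsTRDF? : (G : Graph n) (f : Fin n → Fin 3) → Dec (IsTRDF G f)
IsTRDF? G f =
  all? (λ v → toℕ (f v) ℕ.≟ 0 →-dec any? (λ u → (adj G v u Bool.≟ true) ×-dec (toℕ (f u) ℕ.≟ 2)))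
  ×-dec
  all? (λ v → ¬? (toℕ (f v) ℕ.≟ 0) →-dec any? (λ u → (adj G v u Bool.≟ true) ×-dec ¬? (toℕ (f u) ℕ.≟ 0)))

TRDFBelow : Graph n → ℕ → Set
TRDFBelow {n} G k = ∃[ f ] (IsTRDF G f × weight f < k)

TRDFBelow? : (G : Graph n) (k : ℕ) → Dec (TRDFBelow G k)
TRDFBelow? {n} G k =
  ∃-function? n (λ f → IsTRDF G f × weight f < k)
    (λ f≗g (t , w<k) → IsTRDF-cong G f≗g t , subst (_< k) (weight-cong f≗g) w<k)
    (λ f → IsTRDF? G f ×-dec (weight f <? k))

IsγtR-intro : (G : Graph n) (f : Fin n → Fin 3) → IsTRDF G f → weight f ≡ k →
  ¬ TRDFBelow G k → IsγtR G k
IsγtR-intro G f t wf≡k ¬below = (f , t , wf≡k) , λ g tg → ≮⇒≥ (λ wg<k → ¬below (g , tg , wg<k))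

γtR-exists-below : (G : Graph n) (f : Fin n → Fin 3) → IsTRDF G f →
  Acc _<_ (weight f) → ∃ (IsγtR G)
γtR-exists-below G f t (acc smaller) with TRDFBelow? G (weight f)
... | yes (g , tg , wg<wf) = γtR-exists-below G g tg (smaller wg<wf)
... | no ¬below = weight f , IsγtR-intro G f t refl ¬below

IsTRDF-all-one : (G : Graph n) → NoIsolated G → IsTRDF G (λ _ → # 1)
IsTRDF-all-one G noIsolated = (λ v ()) , (λ v _ → let (u , v~u) = noIsolated v in u , v~u , λ ())

γtR-exists : (G : Graph n) → NoIsolated G → ∃ (IsγtR G)
γtR-exists G noIsolated =
  γtR-exists-below G (λ _ → # 1) (IsTRDF-all-one G noIsolated) (<-wellFounded _)

γtR<-of-TRDFBelow : (G : Graph n) → IsγtR G m → TRDFBelow G k → m < k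
γtR<-of-TRDFBelow G (_ , minimal) (f , t , wf<k) = ≤-<-trans (minimal f t) wf<k

IsTRDF-mono : (G H : Graph n) → SpanningSubgraph G H → ∀ f → IsTRDF G f → IsTRDF H f
IsTRDF-mono G H G⊆H f (dominated , paired) =
  (λ v fv≡0 → let (u , v~u , fu≡2) = dominated v fv≡0 in u , G⊆H v u v~u , fu≡2) ,
  (λ v fv≢0 → let (u , v~u , fu≢0) = paired v fv≢0 in u , G⊆H v u v~u , fu≢0)

TRDFBelow-mono : (G H : Graph n) → SpanningSubgraph G H → TRDFBelow G k → TRDFBelow H k
TRDFBelow-mono G H G⊆H (f , t , wf<k) = f , IsTRDF-mono G H G⊆H f t , wf<k

NoIsolated-mono : (G H : Graph n) → SpanningSubgraph G H → NoIsolated G → NoIsolated H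
NoIsolated-mono G H G⊆H noIsolated v = let (u , v~u) = noIsolated v in u , G⊆H v u v~u

⊆-refl : (G : Graph n) → SpanningSubgraph G G
⊆-refl G x y x~y = x~y

⊆-trans : (G H K : Graph n) → SpanningSubgraph G H → SpanningSubgraph H K → SpanningSubgraph G K
⊆-trans G H K G⊆H H⊆K x y x~y = H⊆K x y (G⊆H x y x~y)

⊆-addEdge : (G : Graph n) (u v : Fin n) (u≢v : u ≢ v) → SpanningSubgraph G (addEdge G u v u≢v)
⊆-addEdge G u v u≢v x y x~y rewrite x~y = refl

addEdge-mono : (G H : Graph n) → SpanningSubgraph G H → (u v : Fin n) (u≢v : u ≢ v) →
  SpanningSubgraph (addEdge G u v u≢v) (addEdge H u v u≢v)
addEdge-mono G H G⊆H u v u≢v x y x~y with adj G x y in G-xy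
... | true rewrite G⊆H x y G-xy = refl
... | false rewrite x~y = ∨-zeroʳ (adj H x y)

eqb-refl : (x : Fin n) → eqb x x ≡ true
eqb-refl x with x ≟ x
... | yes _ = refl
... | no x≢x = contradiction refl x≢x

addEdge-adj : (G : Graph n) (u v : Fin n) (u≢v : u ≢ v) → Adj (addEdge G u v u≢v) u v
addEdge-adj G u v u≢v rewrite eqb-refl u | eqb-refl v = ∨-zeroʳ (adj G u v)

γtR-addEdge : (G : Graph n) (u v : Fin n) (u≢v : u ≢ v) → IsγtR G k →
  ¬ TRDFBelow (addEdge G u v u≢v) k → IsγtR (addEdge G u v u≢v) k
γtR-addEdge G u v u≢v ((f , t , wf≡k) , _) =
  IsγtR-intro (addEdge G u v u≢v) f (IsTRDF-mono G (addEdge G u v u≢v) (⊆-addEdge G u v u≢v) f t) wf≡k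

Complete : Graph n → Set
Complete {n} G = ∀ (u v : Fin n) → u ≢ v → Adj G u v

twoOneZeros : Fin (suc (suc n)) → Fin 3
twoOneZeros = # 2 ∷ᵥ # 1 ∷ᵥ λ _ → Fin.zero

weight-twoOneZeros : weight (twoOneZeros {n}) ≡ 3
weight-twoOneZeros {n} = begin
  weight (twoOneZeros {n})                ≡⟨ weight-suc (twoOneZeros {n}) ⟩
  2 + weight (tail (twoOneZeros {n}))     ≡⟨ cong (2 +_) (weight-suc (tail (twoOneZeros {n}))) ⟩
  2 + (1 + weight {n} (λ _ → Fin.zero))   ≡⟨ cong (λ w → 2 + (1 + w)) (weight-zero {n}) ⟩
  3                                       ∎
  where open ≡-Reasoning

IsTRDF-complete : (G : Graph (suc (suc n))) → Complete G → IsTRDF G twoOneZeros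
IsTRDF-complete {n} G complete = dominated , paired
  where
    f : Fin (suc (suc n)) → Fin 3
    f = twoOneZeros

    dominated : ∀ v → toℕ (f v) ≡ 0 → ∃[ u ] (Adj G v u × toℕ (f u) ≡ 2)
    dominated (Fin.suc (Fin.suc _)) _ = Fin.zero , complete _ _ (λ ()) , refl

    paired : ∀ v → ¬ toℕ (f v) ≡ 0 → ∃[ u ] (Adj G v u × ¬ toℕ (f u) ≡ 0)
    paired Fin.zero _ = # 1 , complete _ _ (λ ()) , λ ()
    paired (Fin.suc Fin.zero) _ = Fin.zero , complete _ _ (λ ()) , λ ()
    paired (Fin.suc (Fin.suc _)) fv≢0 = contradiction refl fv≢0

γtR-complete-≤3 : (G : Graph n) → NoIsolated G → Complete G → IsγtR G k → k ≤ 3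
γtR-complete-≤3 {zero} G _ _ (_ , minimal) = ≤-trans (minimal (λ ()) ((λ ()) , (λ ()))) z≤n
γtR-complete-≤3 {suc zero} G noIsolated _ _ with noIsolated Fin.zero
... | Fin.zero , 0~0 = contradiction (trans (sym 0~0) (adj-irrefl G Fin.zero)) λ ()
γtR-complete-≤3 {suc (suc n)} {k} G _ complete (_ , minimal) =
  subst (k ≤_) (weight-twoOneZeros {n}) (minimal twoOneZeros (IsTRDF-complete G complete))

nonEdge-exists : (G : Graph n) → NoIsolated G → IsγtR G k → 4 ≤ k → ∃[ u ] ∃[ v ] NonEdge G u v
nonEdge-exists G noIsolated γ 4≤k
  with any? (λ u → any? (λ v → ¬? (u ≟ v) ×-dec (adj G u v Bool.≟ false)))
... | yes nonEdge = nonEdge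
... | no noNonEdge = contradiction (γtR-complete-≤3 G noIsolated complete γ) (<⇒≱ 4≤k)
  where
    complete : Complete G
    complete u v u≢v = ¬-not (λ uv-false → noNonEdge (u , v , u≢v , uv-false))

module EdgeAddition (k : ℕ) where

  CriticalPair : Graph n → Fin n × Fin n → Set
  CriticalPair G (u , v) = (u≢v : u ≢ v) → TRDFBelow (addEdge G u v u≢v) k ⊎ Adj G u v

  CriticalPair-mono : (G H : Graph n) → SpanningSubgraph G H → ∀ q → CriticalPair G q → CriticalPair H q
  CriticalPair-mono G H G⊆H (u , v) critical u≢v with critical u≢v
  ... | inj₁ below = inj₁ (TRDFBelow-mono (addEdge G u v u≢v) (addEdge H u v u≢v)
                                          (addEdge-mono G H G⊆H u v u≢v) below)
  ... | inj₂ u~v = inj₂ (G⊆H u v u~v)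

  Saturation : Graph n → (Graph n → Set) → Set
  Saturation {n} G P = Σ (Graph n) λ H → SpanningSubgraph G H × IsγtR H k × P H

  saturate-pair : (G : Graph n) → IsγtR G k → ∀ q → Saturation G (λ H → CriticalPair H q)
  saturate-pair G γ (u , v) with u ≟ v
  ... | yes u≡v = G , ⊆-refl G , γ , λ u≢v → contradiction u≡v u≢v
  ... | no u≢v with TRDFBelow? (addEdge G u v u≢v) k
  ...   | yes below = G , ⊆-refl G , γ , λ _ → inj₁ below
  ...   | no ¬below = addEdge G u v u≢v , ⊆-addEdge G u v u≢v ,
                      γtR-addEdge G u v u≢v γ ¬below , λ _ → inj₂ (addEdge-adj G u v u≢v)

  saturate : (G : Graph n) → IsγtR G k → ∀ L → Saturation G (λ H → All (CriticalPair H) L)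
  saturate G γ [] = G , ⊆-refl G , γ , []
  saturate G γ (q ∷ L) =
    let (G₁ , G⊆G₁ , γ₁ , critical) = saturate-pair G γ q
        (H , G₁⊆H , γH , criticals) = saturate G₁ γ₁ L
    in H , ⊆-trans G G₁ H G⊆G₁ G₁⊆H , γH , CriticalPair-mono G₁ H G₁⊆H q critical ∷ criticals

  addEdge-lowers-γtR : (H : Graph n) → NoIsolated H → ∀ u v → CriticalPair H (u , v) →
    (uv : NonEdge H u v) → ∃[ m ] (m < k × IsγtR (addEdge H u v (proj₁ uv)) m)
  addEdge-lowers-γtR H noIsolated u v critical (u≢v , uv-false) with critical u≢v
  ... | inj₁ below =
    let (m , γm) = γtR-exists (addEdge H u v u≢v)
                     (NoIsolated-mono H (addEdge H u v u≢v) (⊆-addEdge H u v u≢v) noIsolated)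
    in m , γtR<-of-TRDFBelow (addEdge H u v u≢v) γm below , γm
  ... | inj₂ u~v = contradiction (trans (sym u~v) uv-false) λ ()

allPairs : (n : ℕ) → List (Fin n × Fin n)
allPairs n = cartesianProduct (allFin n) (allFin n)

mainTheorem15 : ∀ (n : ℕ) (G : Graph n) (k : ℕ) →
    NoIsolated G → IsγtR G k → 4 ≤ k →
    Σ (Graph n) (λ H → SpanningSubgraph G H × EdgeCritical H k)
mainTheorem15 n G k noIsolated γG 4≤k =
  let open EdgeAddition k
      (H , G⊆H , γH , criticals) = saturate G γG (allPairs n)
      noIsolatedH = NoIsolated-mono G H G⊆H noIsolated
  in H , G⊆H , noIsolatedH , γH , nonEdge-exists H noIsolatedH γH 4≤k ,
     λ u v → addEdge-lowers-γtR H noIsolatedH u v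
               (lookup criticals (∈-cartesianProduct⁺ (∈-allFin u) (∈-allFin v)))
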